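{- Let $G$ be a directed graph, $r$ a vertex of $G$, and $T, T'$ two $r$-directed trees in $G$ with $|T|=|T'|=k$. Then there is a sequence $\langle T=T_0, T_1, \ldots, T_\ell=T'\rangle$ of $r$-directed trees in $G$ such that $|A(T_i)\setminus A(T_{i+1})| = |A(T_{i+1})\setminus A(T_i)|=1$ for all $0\le i<\ell$, and $\ell\le k$.
   Context: A directed tree is a directed graph whose underlying undirected graph is a tree and in which every vertex except one vertex $r$ has in-degree exactly $1$; $r$ is its root and the tree is called an $r$-directed tree. $|T|$ denotes the number of arcs of $T$. -}

module Defs where

open import Data.Nat using (ℕ; suc)
open import Data.Fin using (Fin; _≟_)
open import Data.Fin.Subset using (Subset; _∈_; _∩_; ∣_∣)
open import Data.Vec using (tabulate)
open import Data.List using (List; []; _∷_)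
open import Data.List.Relation.Unary.Unique.Propositional using (Unique)
open import Data.Product using (Σ; ∃; _×_; _,_)
open import Data.Sum using (_⊎_)
open import Relation.Nullary using (¬_; does)
open import Relation.Binary.PropositionalEquality using (_≡_)

record Digraph : Set where
  field
    n    : ℕ
    m    : ℕ
    tail : Fin m → Fin n
    head : Fin m → Fin n

module _ (G : Digraph) where
  open Digraph G

  -- A subgraph is given by its set of arcs A ⊆ A(G); a subgraph rooted at r
  -- has vertex set {r} ∪ {endpoints of arcs in A}.
  InV : Fin n → Subset m → Fin n → Set
  InV r A x = x ≡ r ⊎ ∃ λ e → e ∈ A × (tail e ≡ x ⊎ head e ≡ x)

  data UWalk (A : Subset m) : Fin n → Fin n → List (Fin m) → Set where
    nil : ∀ {u} → UWalk A u u []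
    fwd : ∀ {u w es} e → e ∈ A → tail e ≡ u → UWalk A (head e) w es → UWalk A u w (e ∷ es)
    bwd : ∀ {u w es} e → e ∈ A → head e ≡ u → UWalk A (tail e) w es → UWalk A u w (e ∷ es)

  UConnected : Fin n → Subset m → Set
  UConnected r A = ∀ x y → InV r A x → InV r A y → ∃ λ es → UWalk A x y es

  UAcyclic : Subset m → Set
  UAcyclic A = ∀ u e es → UWalk A u u (e ∷ es) → ¬ Unique (e ∷ es)

  InArcs : Fin n → Subset m
  InArcs x = tabulate (λ e → does (head e ≟ x))

  indeg : Subset m → Fin n → ℕ
  indeg A x = ∣ A ∩ InArcs x ∣

  IsRDirectedTree : Fin n → Subset m → Set
  IsRDirectedTree r A =
    UConnected r A × UAcyclic A × (∀ x → InV r A x → ¬ (x ≡ r) → indeg A x ≡ 1)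

{-# OPTIONS --safe #-}
module Submission where

-- An r-directed tree is the same as a set of arcs in which no arc enters r,
-- no two arcs share a head, and every vertex is reached from r by a directed
-- path.  To get from T to T′, grow a common sub-arborescence P of T′ and of
-- the current tree X, one arc a′ of T′ leaving V(P) at a time.  If a′ ∈ X,
-- X stays; if head a′ ∈ V(X), a′ replaces the in-arc of head a′ in X;
-- otherwise a′ is added to X and the arc outside P + a′ with the deepest
-- head, necessarily a leaf, is removed.  Every round adds an arc to P and
-- costs at most one exchange, so at most k exchanges are made.

open import Defs
open import Data.Nat using (ℕ; zero; suc; _+_; _≤_; _<_; z≤n; s≤s)
open import Data.Nat.Properties
  using (≤-refl; ≤-trans; <-trans; <-irrefl; <-≤-trans; <⇒≱; ≤-reflexive; ≤-pred; ≤-total;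
         n<1+n; m≤n⇒∃[o]m+o≡n; m≤n+m; m<m+n; m≤n⇒m≤1+n; +-suc; +-identityʳ)
import Data.Nat.Properties as ℕ
open import Data.Fin using (Fin; zero; suc; toℕ; fromℕ; inject₁; _≟_)
open import Data.Fin.Properties using (any?; suc-injective; pigeonhole; toℕ≤pred[n])
open import Data.Fin.Subset using (Subset; inside; outside; _∈_; _∉_; _⊆_; _∩_; _─_; ∣_∣; ⊥)
open import Data.Fin.Subset.Properties
  using (_∈?_; x∈p∩q⁺; x∈p∩q⁻; p⊆q⇒∣p∣≤∣q∣; p⊂q⇒∣p∣<∣q∣; ⊆-antisym; ⊆-min;
         x∈p∧x∉q⇒x∈p─q; ∉⊥; ∣⊥∣≡0; Empty-unique)
open import Data.Vec using (_∷_; []; _[_]≔_; tabulate; here; there)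
open import Data.Vec.Properties using ([]≔-updates; []≔-minimal)
open import Data.List using (List; _∷_; []; _++_)
import Data.List as List
open import Data.List.Membership.Propositional using () renaming (_∈_ to _∈ₗ_)
open import Data.List.Relation.Unary.Any using (here; there)
open import Data.List.Relation.Unary.All using () renaming (lookup to All-lookup)
open import Data.List.Relation.Unary.AllPairs using (_∷_)
open import Data.List.Relation.Unary.Unique.Propositional using (Unique)
open import Data.List.Relation.Unary.Unique.Propositional.Properties using (tabulate⁺)
open import Data.Product using (Σ; ∃; ∃₂; _×_; _,_; proj₁; proj₂)
open import Data.Sum using (_⊎_; inj₁; inj₂)
import Data.Sum as Sum
open import Data.Empty using (⊥-elim)
open import Relation.Nullary using (¬_; Dec; yes; no; does; contradiction; ¬?; _×-dec_; _⊎-dec_)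
open import Relation.Binary.PropositionalEquality
  using (_≡_; _≢_; refl; sym; trans; cong; subst)

private variable
  k l : ℕ

x∈p─q⁻ : ∀ {x : Fin k} (p q : Subset k) → x ∈ p ─ q → x ∈ p × x ∉ q
x∈p─q⁻ (inside ∷ p) (outside ∷ q) here = here , λ ()
x∈p─q⁻ {x = zero} (outside ∷ p) (inside ∷ q) ()
x∈p─q⁻ {x = zero} (outside ∷ p) (outside ∷ q) ()
x∈p─q⁻ {x = suc x} (s ∷ p) (t ∷ q) (there x∈p─q) with x∈p─q⁻ p q x∈p─q
... | x∈p , x∉q = there x∈p , λ { (there x∈q) → x∉q x∈q }

∈-fiber⁻ : ∀ (f : Fin l → Fin k) x e → e ∈ tabulate (λ i → does (f i ≟ x)) → f e ≡ x
∈-fiber⁻ f x zero e∈ with f zero ≟ x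
... | yes fe≡x = fe≡x
∈-fiber⁻ f x (suc e) (there e∈) = ∈-fiber⁻ (λ i → f (suc i)) x e e∈

∈-fiber⁺ : ∀ (f : Fin l → Fin k) x e → f e ≡ x → e ∈ tabulate (λ i → does (f i ≟ x))
∈-fiber⁺ f x zero fe≡x with f zero ≟ x
... | yes _   = here
... | no fe≢x = contradiction fe≡x fe≢x
∈-fiber⁺ f x (suc e) fe≡x = there (∈-fiber⁺ (λ i → f (suc i)) x e fe≡x)

∈-insert⁻ : ∀ (p : Subset k) a {e} → e ∈ p [ a ]≔ inside → e ≡ a ⊎ e ∈ p
∈-insert⁻ (s ∷ p)       zero    {zero}  _         = inj₁ refl
∈-insert⁻ (s ∷ p)       zero    {suc e} (there h) = inj₂ (there h)
∈-insert⁻ (inside ∷ p)  (suc a) {zero}  _         = inj₂ here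
∈-insert⁻ (s ∷ p)       (suc a) {suc e} (there h) =
  Sum.map (cong suc) there (∈-insert⁻ p a h)

∈-insert-self : ∀ (p : Subset k) a → a ∈ p [ a ]≔ inside
∈-insert-self p a = []≔-updates p a

⊆-insert : ∀ (p : Subset k) a → p ⊆ p [ a ]≔ inside
⊆-insert p a {e} e∈p with e ≟ a
... | yes refl = ∈-insert-self p a
... | no e≢a   = []≔-minimal p e a e≢a e∈p

insert-⊆ : ∀ {p q : Subset k} {a} → p ⊆ q → a ∈ q → p [ a ]≔ inside ⊆ q
insert-⊆ {p = p} {a = a} p⊆q a∈q h with ∈-insert⁻ p a h
... | inj₁ refl = a∈q
... | inj₂ e∈p  = p⊆q e∈p

∈-remove⁻ : ∀ (p : Subset k) a {e} → e ∈ p [ a ]≔ outside → e ≢ a × e ∈ p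
∈-remove⁻ (s ∷ p)      zero    {suc e} (there h) = (λ ()) , there h
∈-remove⁻ (inside ∷ p) (suc a) {zero}  h         = (λ ()) , here
∈-remove⁻ (s ∷ p)      (suc a) {suc e} (there h) with ∈-remove⁻ p a h
... | e≢a , e∈p = (λ eq → e≢a (suc-injective eq)) , there e∈p

∈-remove⁺ : ∀ (p : Subset k) a {e} → e ≢ a → e ∈ p → e ∈ p [ a ]≔ outside
∈-remove⁺ p a {e} e≢a e∈p = []≔-minimal p e a e≢a e∈p

∣insert∣ : ∀ (p : Subset k) a → a ∉ p → ∣ p [ a ]≔ inside ∣ ≡ suc ∣ p ∣
∣insert∣ (inside ∷ p)  zero    a∉p = contradiction here a∉p
∣insert∣ (outside ∷ p) zero    a∉p = refl
∣insert∣ (inside ∷ p)  (suc a) a∉p = cong suc (∣insert∣ p a (λ h → a∉p (there h)))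
∣insert∣ (outside ∷ p) (suc a) a∉p = ∣insert∣ p a (λ h → a∉p (there h))

∣remove∣ : ∀ (p : Subset k) a → a ∈ p → ∣ p ∣ ≡ suc ∣ p [ a ]≔ outside ∣
∣remove∣ (inside ∷ p)  zero    a∈p         = refl
∣remove∣ (inside ∷ p)  (suc a) (there a∈p) = cong suc (∣remove∣ p a a∈p)
∣remove∣ (outside ∷ p) (suc a) (there a∈p) = ∣remove∣ p a a∈p

∣p∣≡suc⇒nonempty : ∀ (p : Subset k) {c} → ∣ p ∣ ≡ suc c → ∃ λ e → e ∈ p
∣p∣≡suc⇒nonempty (inside ∷ p)  _   = zero , here
∣p∣≡suc⇒nonempty (outside ∷ p) eq with ∣p∣≡suc⇒nonempty p eq
... | e , e∈p = suc e , there e∈p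

∣p∣≡1⇒unique : ∀ (p : Subset k) → ∣ p ∣ ≡ 1 → ∀ {e f} → e ∈ p → f ∈ p → e ≡ f
∣p∣≡1⇒unique p ∣p∣≡1 {e} {f} e∈p f∈p with e ≟ f
... | yes e≡f = e≡f
... | no e≢f  = contradiction
  (trans (ℕ.suc-injective (trans (sym ∣p∣≡1) (∣remove∣ p f f∈p)))
         (∣remove∣ (p [ f ]≔ outside) e (∈-remove⁺ p f e≢f e∈p)))
  (λ ())

unique⇒∣p∣≡1 : ∀ {k} (p : Subset k) {a} → a ∈ p → (∀ {e} → e ∈ p → e ≡ a) → ∣ p ∣ ≡ 1
unique⇒∣p∣≡1 {k} p {a} a∈p unique = trans (∣remove∣ p a a∈p) (cong suc removed-empty)
  where
  removed-empty : ∣ p [ a ]≔ outside ∣ ≡ 0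
  removed-empty = trans (cong ∣_∣ (Empty-unique λ (e , h) →
    let e≢a , e∈p = ∈-remove⁻ p a h in e≢a (unique e∈p))) (∣⊥∣≡0 k)

⊆-or-∃∉ : ∀ (p q : Subset k) → q ⊆ p ⊎ ∃ λ e → e ∈ q × e ∉ p
⊆-or-∃∉ p q with any? (λ e → (e ∈? q) ×-dec ¬? (e ∈? p))
... | yes new = inj₂ new
... | no ¬new = inj₁ q⊆p
  where
  q⊆p : q ⊆ p
  q⊆p {e} e∈q with e ∈? p
  ... | yes e∈p = e∈p
  ... | no e∉p  = ⊥-elim (¬new (e , e∈q , e∉p))

∣p∣<∣q∣⇒∃∉ : ∀ (p q : Subset k) → ∣ p ∣ < ∣ q ∣ → ∃ λ e → e ∈ q × e ∉ p
∣p∣<∣q∣⇒∃∉ p q ∣p∣<∣q∣ with ⊆-or-∃∉ p q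
... | inj₁ q⊆p = ⊥-elim (<⇒≱ ∣p∣<∣q∣ (p⊆q⇒∣p∣≤∣q∣ q⊆p))
... | inj₂ new = new

⊆∧∣q∣≤∣p∣⇒≡ : ∀ {p q : Subset k} → p ⊆ q → ∣ q ∣ ≤ ∣ p ∣ → p ≡ q
⊆∧∣q∣≤∣p∣⇒≡ {p = p} {q} p⊆q ∣q∣≤∣p∣ with ⊆-or-∃∉ p q
... | inj₁ q⊆p = ⊆-antisym p⊆q q⊆p
... | inj₂ (e , e∈q , e∉p) = ⊥-elim (<⇒≱ (p⊂q⇒∣p∣<∣q∣ (p⊆q , e , e∈q , e∉p)) ∣q∣≤∣p∣)

shift-suc : ∀ {q p j t} → q ≡ suc p → p + suc j ≡ t → q + j ≡ t
shift-suc {p = p} {j} refl refl = sym (+-suc p j)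

Exchange : Subset k → Subset k → Set
Exchange X Y = ∣ X ─ Y ∣ ≡ 1 × ∣ Y ─ X ∣ ≡ 1

exchange : ∀ {X X′ : Subset k} {a a′} → a ∈ X → a ∉ X′ → a′ ∈ X′ → a′ ∉ X →
  (∀ {e} → e ∈ X′ → e ≡ a′ ⊎ e ∈ X) → (∀ {e} → e ∈ X → e ≢ a → e ∈ X′) → Exchange X X′
exchange {X = X} {X′} {a} {a′} a∈X a∉X′ a′∈X′ a′∉X X′⊆X+a′ X-a⊆X′ =
  unique⇒∣p∣≡1 (X ─ X′) (x∈p∧x∉q⇒x∈p─q a∈X a∉X′) removed ,
  unique⇒∣p∣≡1 (X′ ─ X) (x∈p∧x∉q⇒x∈p─q a′∈X′ a′∉X) added
  where
  removed : ∀ {e} → e ∈ X ─ X′ → e ≡ a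
  removed {e} h with x∈p─q⁻ X X′ h | e ≟ a
  ... | _          | yes e≡a = e≡a
  ... | e∈X , e∉X′ | no e≢a  = contradiction (X-a⊆X′ e∈X e≢a) e∉X′
  added : ∀ {e} → e ∈ X′ ─ X → e ≡ a′
  added h with x∈p─q⁻ X′ _ h
  ... | e∈X′ , e∉X with X′⊆X+a′ e∈X′
  ... | inj₁ e≡a′ = e≡a′
  ... | inj₂ e∈X  = contradiction e∈X e∉X

argmax : ∀ (P : Fin k → Set) → (∀ e → Dec (P e)) → (f : Fin k → ℕ) → ∃ P →
         ∃ λ b → P b × (∀ e → P e → f e ≤ f b)
argmax {suc k} P P? f w with any? (λ e → P? (suc e)) | w
... | no ¬w′ | zero , pz  = zero , pz , λ { zero _ → ≤-refl ; (suc e) pe → ⊥-elim (¬w′ (e , pe)) }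
... | no ¬w′ | suc e , pe = ⊥-elim (¬w′ (e , pe))
... | yes w′ | _ with argmax (λ e → P (suc e)) (λ e → P? (suc e)) (λ e → f (suc e)) w′ | P? zero
... | b , pb , max | no ¬pz = suc b , pb , λ { zero pz → contradiction pz ¬pz ; (suc e) pe → max e pe }
... | b , pb , max | yes pz with ≤-total (f zero) (f (suc b))
... | inj₁ le = suc b , pb , λ { zero _ → le ; (suc e) pe → max e pe }
... | inj₂ ge = zero , pz , λ { zero _ → ≤-refl ; (suc e) pe → ≤-trans (max e pe) ge }

injective-or-collision : ∀ (f : Fin l → Fin k) →
  (∀ {a b} → f a ≡ f b → a ≡ b) ⊎ ∃₂ λ a b → toℕ a < toℕ b × f a ≡ f b
injective-or-collision {zero} f = inj₁ λ { {()} }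
injective-or-collision {suc l} f with any? (λ b → f zero ≟ f (suc b))
... | yes (b , eq) = inj₂ (zero , suc b , s≤s z≤n , eq)
... | no ¬eq with injective-or-collision (λ b → f (suc b))
... | inj₂ (a , b , a<b , eq) = inj₂ (suc a , suc b , s≤s a<b , eq)
... | inj₁ inj = inj₁ injective
  where
  injective : ∀ {a b} → f a ≡ f b → a ≡ b
  injective {zero}  {zero}  _  = refl
  injective {zero}  {suc b} eq = ⊥-elim (¬eq (b , eq))
  injective {suc a} {zero}  eq = ⊥-elim (¬eq (a , sym eq))
  injective {suc a} {suc b} eq = cong suc (inj eq)

module Arborescences (G : Digraph) (r : Fin (Digraph.n G)) where
  open Digraph G

  V : Subset m → Fin n → Set
  V = InV G r

  V? : ∀ A x → Dec (V A x)
  V? A x = (x ≟ r) ⊎-dec any? (λ e → (e ∈? A) ×-dec ((tail e ≟ x) ⊎-dec (head e ≟ x)))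

  r∈V : ∀ {A} → V A r
  r∈V = inj₁ refl

  tail∈V : ∀ {A e} → e ∈ A → V A (tail e)
  tail∈V {e = e} e∈A = inj₂ (e , e∈A , inj₁ refl)

  head∈V : ∀ {A e} → e ∈ A → V A (head e)
  head∈V {e = e} e∈A = inj₂ (e , e∈A , inj₂ refl)

  V-mono : ∀ {A B} → A ⊆ B → ∀ {x} → V A x → V B x
  V-mono A⊆B (inj₁ x≡r)               = inj₁ x≡r
  V-mono A⊆B (inj₂ (e , e∈A , ends)) = inj₂ (e , A⊆B e∈A , ends)

  V-insert⁻ : ∀ {A a} → V A (tail a) → ∀ {x} → V (A [ a ]≔ inside) x → V A x ⊎ x ≡ head a
  V-insert⁻ tail∈VA (inj₁ x≡r) = inj₁ (inj₁ x≡r)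
  V-insert⁻ {A} {a} tail∈VA (inj₂ (e , e∈A+a , ends)) with ∈-insert⁻ A a e∈A+a | ends
  ... | inj₂ e∈A | _          = inj₁ (inj₂ (e , e∈A , ends))
  ... | inj₁ refl | inj₁ refl = inj₁ tail∈VA
  ... | inj₁ refl | inj₂ refl = inj₂ refl

  data Reach (A : Subset m) : Fin n → Set where
    root : Reach A r
    step : ∀ {x} e → e ∈ A → head e ≡ x → Reach A (tail e) → Reach A x

  Reach-mono : ∀ {A B} → A ⊆ B → ∀ {x} → Reach A x → Reach B x
  Reach-mono A⊆B root              = root
  Reach-mono A⊆B (step e e∈A eq R) = step e (A⊆B e∈A) eq (Reach-mono A⊆B R)

  Reach⇒in-arc : ∀ {A x} → Reach A x → x ≢ r → ∃ λ e → e ∈ A × head e ≡ x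
  Reach⇒in-arc root              x≢r = contradiction refl x≢r
  Reach⇒in-arc (step e e∈A eq _) _   = e , e∈A , eq

  pathLength : ∀ {A x} → Reach A x → ℕ
  pathLength root           = 0
  pathLength (step _ _ _ R) = suc (pathLength R)

  NoArcIntoRoot : Subset m → Set
  NoArcIntoRoot A = ∀ {e} → e ∈ A → head e ≢ r

  HeadInjective : Subset m → Set
  HeadInjective A = ∀ {e f} → e ∈ A → f ∈ A → head e ≡ head f → e ≡ f

  record Arborescence (A : Subset m) : Set where
    constructor arborescence
    field
      no-arc-into-root : NoArcIntoRoot A
      head-injective   : HeadInjective A
      reachable        : ∀ x → V A x → Reach A x

  pathLength-unique : ∀ {A} → NoArcIntoRoot A → HeadInjective A →
                      ∀ {x} (R R′ : Reach A x) → pathLength R ≡ pathLength R′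
  pathLength-unique no-root inj root             root               = refl
  pathLength-unique no-root inj root             (step e e∈A eq _)  = ⊥-elim (no-root e∈A eq)
  pathLength-unique no-root inj (step e e∈A eq _) root              = ⊥-elim (no-root e∈A eq)
  pathLength-unique no-root inj (step e e∈A eq R) (step f f∈A eq′ R′)
    with inj e∈A f∈A (trans eq (sym eq′))
  ... | refl = cong suc (pathLength-unique no-root inj R R′)

  module Depth {A} (arb : Arborescence A) where
    open Arborescence arb

    depth : Fin n → ℕ
    depth x with V? A x
    ... | yes x∈V = pathLength (reachable x x∈V)
    ... | no _    = 0

    depth-pathLength : ∀ {x} → V A x → (R : Reach A x) → depth x ≡ pathLength R
    depth-pathLength {x} x∈V R with V? A x
    ... | yes x∈V′ = pathLength-unique no-arc-into-root head-injective (reachable x x∈V′) R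
    ... | no x∉V   = contradiction x∈V x∉V

    depth-< : ∀ {e} → e ∈ A → depth (tail e) < depth (head e)
    depth-< {e} e∈A = ≤-reflexive (trans
      (cong suc (depth-pathLength (tail∈V e∈A) R))
      (sym (depth-pathLength (head∈V e∈A) (step e e∈A refl R))))
      where
      R = reachable (tail e) (tail∈V e∈A)

    -- Since every vertex has at most one in-arc, a trail never turns from
    -- climbing in depth to descending.
    data TrailShape (x y : Fin n) : List (Fin m) → Set where
      empty      : x ≡ y → TrailShape x y []
      ascending  : ∀ {es f} → depth x < depth y → f ∈ₗ es → f ∈ A → head f ≡ y → TrailShape x y es
      descending : ∀ {e es} → head e ≡ x → e ∈ A →
                   depth y < depth x ⊎ (∃ λ f → f ∈ₗ es × f ∈ A × head f ≡ y) → TrailShape x y (e ∷ es)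

    trailShape : ∀ {x y es} → UWalk G A x y es → Unique es → TrailShape x y es
    trailShape nil _ = empty refl
    trailShape (fwd e e∈A refl w) (e∉es ∷ u) with trailShape w u
    ... | empty refl = ascending (depth-< e∈A) (here refl) e∈A refl
    ... | ascending lt f∈es f∈A hf = ascending (<-trans (depth-< e∈A) lt) (there f∈es) f∈A hf
    ... | descending {e′} he′ e′∈A _ =
      contradiction (head-injective e∈A e′∈A (sym he′)) (All-lookup e∉es (here refl))
    trailShape (bwd e e∈A refl w) (_ ∷ u) with trailShape w u
    ... | empty refl = descending refl e∈A (inj₁ (depth-< e∈A))
    ... | ascending _ f∈es f∈A hf = descending refl e∈A (inj₂ (_ , f∈es , f∈A , hf))
    ... | descending _ _ (inj₁ lt) = descending refl e∈A (inj₁ (<-trans lt (depth-< e∈A)))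
    ... | descending _ _ (inj₂ (f , f∈es , f∈A , hf)) =
      descending refl e∈A (inj₂ (f , there f∈es , f∈A , hf))

    acyclic : UAcyclic G A
    acyclic u e es w u-trail with trailShape w u-trail
    ... | ascending lt _ _ _       = <-irrefl refl lt
    ... | descending _ _ (inj₁ lt) = <-irrefl refl lt
    ... | descending he e∈A (inj₂ (f , f∈es , f∈A , hf)) with u-trail
    ... | e∉es ∷ _ = All-lookup e∉es f∈es (head-injective e∈A f∈A (trans he (sym hf)))

  _++ʷ_ : ∀ {A x y z es fs} → UWalk G A x y es → UWalk G A y z fs → UWalk G A x z (es ++ fs)
  nil           ++ʷ w′ = w′
  fwd e h eq w ++ʷ w′ = fwd e h eq (w ++ʷ w′)
  bwd e h eq w ++ʷ w′ = bwd e h eq (w ++ʷ w′)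

  Reach⇒walk-to-root : ∀ {A x} → Reach A x → ∃ λ es → UWalk G A x r es
  Reach⇒walk-to-root root = [] , nil
  Reach⇒walk-to-root (step e e∈A eq R) =
    let es , w = Reach⇒walk-to-root R in e ∷ es , bwd e e∈A eq w

  Reach⇒walk-from-root : ∀ {A x} → Reach A x → ∃ λ es → UWalk G A r x es
  Reach⇒walk-from-root root = [] , nil
  Reach⇒walk-from-root (step e e∈A refl R) =
    let es , w = Reach⇒walk-from-root R in es ++ e ∷ [] , w ++ʷ fwd e e∈A refl nil

  Reach-along-walk : ∀ {A} → NoArcIntoRoot A → HeadInjective A →
                     ∀ {x y es} → UWalk G A x y es → Reach A x → Reach A y
  Reach-along-walk no-root inj nil R = R
  Reach-along-walk no-root inj (fwd e e∈A refl w) R = Reach-along-walk no-root inj w (step e e∈A refl R)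
  Reach-along-walk no-root inj (bwd e e∈A eq w) root = ⊥-elim (no-root e∈A eq)
  Reach-along-walk no-root inj (bwd e e∈A eq w) (step f f∈A eq′ R) with inj e∈A f∈A (trans eq (sym eq′))
  ... | refl = Reach-along-walk no-root inj w R

  Arborescence⇒IsRDirectedTree : ∀ {A} → Arborescence A → IsRDirectedTree G r A
  Arborescence⇒IsRDirectedTree {A} arb = connected , Depth.acyclic arb , indeg≡1
    where
    open Arborescence arb
    connected : UConnected G r A
    connected x y x∈V y∈V =
      let es , w = Reach⇒walk-to-root (reachable x x∈V)
          fs , w′ = Reach⇒walk-from-root (reachable y y∈V)
      in es ++ fs , w ++ʷ w′
    indeg≡1 : ∀ x → V A x → x ≢ r → indeg G A x ≡ 1
    indeg≡1 x x∈V x≢r with Reach⇒in-arc (reachable x x∈V) x≢r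
    ... | e , e∈A , refl = unique⇒∣p∣≡1 (A ∩ InArcs G (head e))
      (x∈p∩q⁺ (e∈A , ∈-fiber⁺ head (head e) e refl))
      λ f∈ → let f∈A , f∈In = x∈p∩q⁻ A _ f∈ in head-injective f∈A e∈A (∈-fiber⁻ head _ _ f∈In)

  ¬every-vertex-entered : ∀ {A} → UAcyclic G A → ¬ (∀ x → V A x → ∃ λ e → e ∈ A × head e ≡ x)
  ¬every-vertex-entered {A} acyclic in-arc =
    let a , b , a<b , eq = pigeonhole (n<1+n n) (λ (a : Fin (suc n)) → up (toℕ a) r)
        y , d , y∈V , cycle , _ = collision⇒cycle r∈V eq a<b
    in noCycle d ≤-refl y∈V cycle
    where
    parent : Fin n → Fin m
    parent x with V? A x
    ... | yes x∈V = proj₁ (in-arc x x∈V)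
    ... | no _    = proj₁ (in-arc r r∈V)

    parent-∈ : ∀ {x} → V A x → parent x ∈ A
    parent-∈ {x} x∈V with V? A x
    ... | yes x∈V′ = proj₁ (proj₂ (in-arc x x∈V′))
    ... | no x∉V   = contradiction x∈V x∉V

    head-parent : ∀ {x} → V A x → head (parent x) ≡ x
    head-parent {x} x∈V with V? A x
    ... | yes x∈V′ = proj₂ (proj₂ (in-arc x x∈V′))
    ... | no x∉V   = contradiction x∈V x∉V

    up : ℕ → Fin n → Fin n
    up zero    x = x
    up (suc i) x = up i (tail (parent x))

    up-∈V : ∀ i {x} → V A x → V A (up i x)
    up-∈V zero    x∈V = x∈V
    up-∈V (suc i) x∈V = up-∈V i (tail∈V (parent-∈ x∈V))

    up-+ : ∀ i j x → up (i + j) x ≡ up j (up i x)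
    up-+ zero    j x = refl
    up-+ (suc i) j x = up-+ i j (tail (parent x))

    parentArcs : ℕ → Fin n → List (Fin m)
    parentArcs i x = List.tabulate {n = i} λ a → parent (up (toℕ a) x)

    ancestorWalk : ∀ i {x} → V A x → UWalk G A x (up i x) (parentArcs i x)
    ancestorWalk zero    x∈V = nil
    ancestorWalk (suc i) x∈V =
      bwd _ (parent-∈ x∈V) (head-parent x∈V) (ancestorWalk i (tail∈V (parent-∈ x∈V)))

    collision⇒cycle : ∀ {x} → V A x → ∀ {a b} → up a x ≡ up b x → a < b →
      ∃₂ λ y d → V A y × up (suc d) y ≡ y × d < b
    collision⇒cycle {x} x∈V {a} q a<b with m≤n⇒∃[o]m+o≡n a<b
    ... | d , refl = up a x , d , up-∈V a x∈V ,
      trans (sym (up-+ a (suc d) x)) (trans (cong (λ i → up i x) (+-suc a d)) (sym q)) ,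
      s≤s (m≤n+m d a)

    -- The parent cycle is a closed trail unless two of its vertices
    -- coincide, and then a shorter cycle sits inside it.
    noCycle : ∀ fuel {d} → d < suc fuel → ∀ {y} → V A y → up (suc d) y ≢ y
    noCycle fuel {d} d≤fuel {y} y∈V cycle
      with injective-or-collision (λ (a : Fin (suc d)) → up (toℕ a) y)
    ... | inj₁ up-injective =
      acyclic y _ _ (subst (λ z → UWalk G A y z (parentArcs (suc d) y)) cycle (ancestorWalk (suc d) y∈V))
        (tabulate⁺ parent-injective)
      where
      parent-injective : ∀ {a b : Fin (suc d)} → parent (up (toℕ a) y) ≡ parent (up (toℕ b) y) → a ≡ b
      parent-injective {a} {b} eq = up-injective (trans (sym (head-parent (up-∈V (toℕ a) y∈V)))
        (trans (cong head eq) (head-parent (up-∈V (toℕ b) y∈V))))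
    noCycle (suc fuel) {d} d≤fuel y∈V cycle | inj₂ (a , b , a<b , eq)
      with collision⇒cycle y∈V eq a<b
    ... | y′ , d′ , y′∈V , cycle′ , d′<b =
      noCycle fuel (<-≤-trans d′<b (≤-trans (toℕ≤pred[n] b) (≤-pred d≤fuel))) y′∈V cycle′
    noCycle zero (s≤s z≤n) y∈V cycle | inj₂ (zero , zero , () , _)

  IsRDirectedTree⇒Arborescence : ∀ {A} → IsRDirectedTree G r A → Arborescence A
  IsRDirectedTree⇒Arborescence {A} (connected , acyclic , indeg≡1) =
    arborescence no-arc-into-root head-injective reachable
    where
    in-arc : ∀ x → V A x → x ≢ r → ∃ λ e → e ∈ A × head e ≡ x
    in-arc x x∈V x≢r with ∣p∣≡suc⇒nonempty (A ∩ InArcs G x) (indeg≡1 x x∈V x≢r)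
    ... | e , e∈ = let e∈A , e∈In = x∈p∩q⁻ A _ e∈ in e , e∈A , ∈-fiber⁻ head x e e∈In

    no-arc-into-root : NoArcIntoRoot A
    no-arc-into-root {e₀} e₀∈A e₀→r = ¬every-vertex-entered acyclic entered
      where
      entered : ∀ x → V A x → ∃ λ e → e ∈ A × head e ≡ x
      entered x x∈V with x ≟ r
      ... | yes refl = e₀ , e₀∈A , e₀→r
      ... | no x≢r   = in-arc x x∈V x≢r

    head-injective : HeadInjective A
    head-injective {e} {f} e∈A f∈A eq =
      ∣p∣≡1⇒unique (A ∩ InArcs G x) (indeg≡1 x (head∈V e∈A) (no-arc-into-root e∈A))
      (x∈p∩q⁺ (e∈A , ∈-fiber⁺ head x e refl)) (x∈p∩q⁺ (f∈A , ∈-fiber⁺ head x f (sym eq)))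
      where
      x = head e

    reachable : ∀ x → V A x → Reach A x
    reachable x x∈V =
      Reach-along-walk no-arc-into-root head-injective (proj₂ (connected r x r∈V x∈V)) root

  open Arborescence

  grow : ∀ {X a} → Arborescence X → V X (tail a) → ¬ V X (head a) → Arborescence (X [ a ]≔ inside)
  grow {X} {a} arbX tail∈VX head∉VX = arborescence no-root inj reach
    where
    no-root : NoArcIntoRoot (X [ a ]≔ inside)
    no-root h with ∈-insert⁻ X a h
    ... | inj₁ refl = λ head≡r → head∉VX (subst (V X) (sym head≡r) r∈V)
    ... | inj₂ e∈X  = no-arc-into-root arbX e∈X

    inj : HeadInjective (X [ a ]≔ inside)
    inj e∈ f∈ eq with ∈-insert⁻ X a e∈ | ∈-insert⁻ X a f∈
    ... | inj₁ refl | inj₁ refl = refl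
    ... | inj₁ refl | inj₂ f∈X  = ⊥-elim (head∉VX (subst (V X) (sym eq) (head∈V f∈X)))
    ... | inj₂ e∈X  | inj₁ refl = ⊥-elim (head∉VX (subst (V X) eq (head∈V e∈X)))
    ... | inj₂ e∈X  | inj₂ f∈X  = head-injective arbX e∈X f∈X eq

    reach : ∀ x → V (X [ a ]≔ inside) x → Reach (X [ a ]≔ inside) x
    reach x x∈V with V-insert⁻ tail∈VX x∈V
    ... | inj₁ x∈VX = Reach-mono (⊆-insert X a) (reachable arbX x x∈VX)
    ... | inj₂ refl =
      step a (∈-insert-self X a) refl (Reach-mono (⊆-insert X a) (reachable arbX (tail a) tail∈VX))

  remove-leaf : ∀ {Y b} → Arborescence Y → b ∈ Y → (∀ {e} → e ∈ Y → tail e ≢ head b) →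
                Arborescence (Y [ b ]≔ outside)
  remove-leaf {Y} {b} arbY b∈Y leaf =
    arborescence (λ h → no-arc-into-root arbY (⊆Y h)) (λ e∈ f∈ → head-injective arbY (⊆Y e∈) (⊆Y f∈))
      λ x x∈V → avoid (reachable arbY x (V-mono ⊆Y x∈V)) (≢head-b x∈V)
    where
    ⊆Y : Y [ b ]≔ outside ⊆ Y
    ⊆Y h = proj₂ (∈-remove⁻ Y b h)

    ≢head-b : ∀ {x} → V (Y [ b ]≔ outside) x → x ≢ head b
    ≢head-b (inj₁ refl) eq = no-arc-into-root arbY b∈Y (sym eq)
    ≢head-b (inj₂ (e , e∈ , inj₁ refl)) eq = leaf (⊆Y e∈) eq
    ≢head-b (inj₂ (e , e∈ , inj₂ refl)) eq =
      proj₁ (∈-remove⁻ Y b e∈) (head-injective arbY (⊆Y e∈) b∈Y eq)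

    avoid : ∀ {x} → Reach Y x → x ≢ head b → Reach (Y [ b ]≔ outside) x
    avoid root _ = root
    avoid (step e e∈Y refl R) e≢ =
      step e (∈-remove⁺ Y b (λ e≡b → e≢ (cong head e≡b)) e∈Y) refl (avoid R (leaf e∈Y))

  deepest-arc-outside : ∀ {Y Q} → Arborescence Y → Arborescence Q → Q ⊆ Y → ∣ Q ∣ < ∣ Y ∣ →
    ∃ λ b → b ∈ Y × b ∉ Q × (∀ {e} → e ∈ Y → tail e ≢ head b)
  deepest-arc-outside {Y} {Q} arbY arbQ Q⊆Y ∣Q∣<∣Y∣ = b , b∈Y , b∉Q , leaf
    where
    open Depth arbY using (depth; depth-<)
    deepest = argmax (λ e → e ∈ Y × e ∉ Q) (λ e → (e ∈? Y) ×-dec ¬? (e ∈? Q)) (λ e → depth (head e))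
      (∣p∣<∣q∣⇒∃∉ Q Y ∣Q∣<∣Y∣)
    b = proj₁ deepest
    b∈Y = proj₁ (proj₁ (proj₂ deepest))
    b∉Q = proj₂ (proj₁ (proj₂ deepest))

    -- Inside Q, head b would have an in-arc of Q, which can only be b; outside
    -- Q, an arc leaving head b would be deeper than b.
    leaf : ∀ {e} → e ∈ Y → tail e ≢ head b
    leaf {e} e∈Y eq with e ∈? Q
    ... | yes e∈Q =
      let c , c∈Q , head-c = Reach⇒in-arc (reachable arbQ (head b) (subst (V Q) eq (tail∈V e∈Q)))
                                          (no-arc-into-root arbY b∈Y)
      in b∉Q (subst (_∈ Q) (head-injective arbY (Q⊆Y c∈Q) b∈Y head-c) c∈Q)
    ... | no e∉Q = <-irrefl refl (<-≤-trans (subst (λ z → depth z < depth (head e)) eq (depth-< e∈Y))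
                                            (proj₂ (proj₂ deepest) e (e∈Y , e∉Q)))

  ExchangeStep : Subset m → Subset m → Set
  ExchangeStep Q X = ∃ λ X′ → Arborescence X′ × Q ⊆ X′ × Exchange X X′ × ∣ X′ ∣ ≡ ∣ X ∣

  swap-in-arc : ∀ {X Q a′} → Arborescence X → Arborescence Q → a′ ∈ Q → Q ⊆ X [ a′ ]≔ inside →
    a′ ∉ X → V X (tail a′) → V X (head a′) → ExchangeStep Q X
  swap-in-arc {X} {Q} {a′} arbX arbQ a′∈Q Q⊆X+a′ a′∉X tail∈VX head∈VX =
    X′ , arborescence no-root inj (λ x x∈V → reroute (reachable arbX x (V-shrink x∈V))) , Q⊆X′ ,
    exchange a∈X a∉X′ (∈-insert-self _ a′) a′∉X (λ h → Sum.map₂ proj₂ (∈X′⁻ h)) X-a⊆X′ , size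
    where
    in-arc = Reach⇒in-arc (reachable arbX (head a′) head∈VX) (no-arc-into-root arbQ a′∈Q)
    a = proj₁ in-arc
    a∈X = proj₁ (proj₂ in-arc)
    head-a = proj₂ (proj₂ in-arc)

    X′ = X [ a ]≔ outside [ a′ ]≔ inside

    ∈X′⁻ : ∀ {e} → e ∈ X′ → e ≡ a′ ⊎ (e ≢ a × e ∈ X)
    ∈X′⁻ h = Sum.map₂ (∈-remove⁻ X a) (∈-insert⁻ _ a′ h)

    X-a⊆X′ : ∀ {e} → e ∈ X → e ≢ a → e ∈ X′
    X-a⊆X′ e∈X e≢a = ⊆-insert _ a′ (∈-remove⁺ X a e≢a e∈X)

    a∉X′ : a ∉ X′
    a∉X′ h with ∈X′⁻ h
    ... | inj₁ a≡a′      = a′∉X (subst (_∈ X) a≡a′ a∈X)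
    ... | inj₂ (a≢a , _) = a≢a refl

    a∉Q : a ∉ Q
    a∉Q a∈Q = a′∉X (subst (_∈ X) (head-injective arbQ a∈Q a′∈Q head-a) a∈X)

    Q⊆X′ : Q ⊆ X′
    Q⊆X′ {e} e∈Q with ∈-insert⁻ X a′ (Q⊆X+a′ e∈Q)
    ... | inj₁ refl = ∈-insert-self _ a′
    ... | inj₂ e∈X  = X-a⊆X′ e∈X λ e≡a → a∉Q (subst (_∈ Q) e≡a e∈Q)

    no-root : NoArcIntoRoot X′
    no-root h with ∈X′⁻ h
    ... | inj₁ refl      = no-arc-into-root arbQ a′∈Q
    ... | inj₂ (_ , e∈X) = no-arc-into-root arbX e∈X

    inj : HeadInjective X′
    inj e∈ f∈ eq with ∈X′⁻ e∈ | ∈X′⁻ f∈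
    ... | inj₁ refl        | inj₁ refl        = refl
    ... | inj₁ refl        | inj₂ (f≢a , f∈X) =
      ⊥-elim (f≢a (head-injective arbX f∈X a∈X (trans (sym eq) (sym head-a))))
    ... | inj₂ (e≢a , e∈X) | inj₁ refl        =
      ⊥-elim (e≢a (head-injective arbX e∈X a∈X (trans eq (sym head-a))))
    ... | inj₂ (_ , e∈X)   | inj₂ (_ , f∈X)   = head-injective arbX e∈X f∈X eq

    V-shrink : ∀ {x} → V X′ x → V X x
    V-shrink (inj₁ x≡r) = inj₁ x≡r
    V-shrink (inj₂ (e , e∈ , ends)) with ∈X′⁻ e∈ | ends
    ... | inj₂ (_ , e∈X) | _         = inj₂ (e , e∈X , ends)
    ... | inj₁ refl      | inj₁ refl = tail∈VX
    ... | inj₁ refl      | inj₂ refl = head∈VX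

    reroute : ∀ {x} → Reach X x → Reach X′ x
    reroute root = root
    reroute (step e e∈X eq R) with e ≟ a
    ... | yes refl = step a′ (∈-insert-self _ a′) (trans (sym head-a) eq)
                       (Reach-mono Q⊆X′ (reachable arbQ (tail a′) (tail∈V a′∈Q)))
    ... | no e≢a   = step e (X-a⊆X′ e∈X e≢a) eq (reroute R)

    size : ∣ X′ ∣ ≡ ∣ X ∣
    size = trans (∣insert∣ (X [ a ]≔ outside) a′ (λ h → a′∉X (proj₂ (∈-remove⁻ X a h))))
                 (sym (∣remove∣ X a a∈X))

  add-and-prune : ∀ {X Q a′} → Arborescence X → Arborescence Q → a′ ∈ Q → Q ⊆ X [ a′ ]≔ inside →
    V X (tail a′) → ¬ V X (head a′) → ∣ Q ∣ ≤ ∣ X ∣ → ExchangeStep Q X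
  add-and-prune {X} {Q} {a′} arbX arbQ a′∈Q Q⊆Y tail∈VX head∉VX ∣Q∣≤∣X∣ =
    X′ , remove-leaf arbY b∈Y leaf , Q⊆X′ ,
    exchange b∈X (λ h → proj₁ (∈-remove⁻ Y b h) refl) (∈-remove⁺ Y b a′≢b (∈-insert-self X a′)) a′∉X
      (λ h → ∈-insert⁻ X a′ (proj₂ (∈-remove⁻ Y b h)))
      (λ e∈X e≢b → ∈-remove⁺ Y b e≢b (⊆-insert X a′ e∈X)) ,
    ℕ.suc-injective (trans (sym (∣remove∣ Y b b∈Y)) ∣Y∣≡1+∣X∣)
    where
    Y = X [ a′ ]≔ inside
    arbY = grow arbX tail∈VX head∉VX
    a′∉X : a′ ∉ X
    a′∉X a′∈X = head∉VX (head∈V a′∈X)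
    ∣Y∣≡1+∣X∣ : ∣ Y ∣ ≡ suc ∣ X ∣
    ∣Y∣≡1+∣X∣ = ∣insert∣ X a′ a′∉X

    outside-arc = deepest-arc-outside arbY arbQ Q⊆Y (subst (∣ Q ∣ <_) (sym ∣Y∣≡1+∣X∣) (s≤s ∣Q∣≤∣X∣))
    b = proj₁ outside-arc
    b∈Y = proj₁ (proj₂ outside-arc)
    b∉Q = proj₁ (proj₂ (proj₂ outside-arc))
    leaf = proj₂ (proj₂ (proj₂ outside-arc))

    a′≢b : a′ ≢ b
    a′≢b a′≡b = b∉Q (subst (_∈ Q) a′≡b a′∈Q)
    b∈X : b ∈ X
    b∈X with ∈-insert⁻ X a′ b∈Y
    ... | inj₁ b≡a′ = ⊥-elim (a′≢b (sym b≡a′))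
    ... | inj₂ b∈X  = b∈X

    X′ = Y [ b ]≔ outside
    Q⊆X′ : Q ⊆ X′
    Q⊆X′ e∈Q = ∈-remove⁺ Y b (λ e≡b → b∉Q (subst (_∈ Q) e≡b e∈Q)) (Q⊆Y e∈Q)

  advance : ∀ {X Q a′} → Arborescence X → Arborescence Q → a′ ∈ Q → Q ⊆ X [ a′ ]≔ inside →
    V X (tail a′) → ∣ Q ∣ ≤ ∣ X ∣ → Q ⊆ X ⊎ ExchangeStep Q X
  advance {X} {Q} {a′} arbX arbQ a′∈Q Q⊆X+a′ tail∈VX ∣Q∣≤∣X∣ with a′ ∈? X | V? X (head a′)
  ... | yes a′∈X | _            = inj₁ λ e∈Q → insert-⊆ (λ e∈X → e∈X) a′∈X (Q⊆X+a′ e∈Q)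
  ... | no a′∉X  | yes head∈VX = inj₂ (swap-in-arc arbX arbQ a′∈Q Q⊆X+a′ a′∉X tail∈VX head∈VX)
  ... | no _     | no head∉VX  = inj₂ (add-and-prune arbX arbQ a′∈Q Q⊆X+a′ tail∈VX head∉VX ∣Q∣≤∣X∣)

  exit-arc : ∀ {P T} → Arborescence P → Arborescence T → P ⊆ T → ∣ P ∣ < ∣ T ∣ →
             ∃ λ a → a ∈ T × V P (tail a) × ¬ V P (head a)
  exit-arc {P} {T} arbP arbT P⊆T ∣P∣<∣T∣ with ∣p∣<∣q∣⇒∃∉ P T ∣P∣<∣T∣
  ... | e , e∈T , e∉P = leave (reachable arbT (head e) (head∈V e∈T)) head-e∉V
    where
    head-e∉V : ¬ V P (head e)
    head-e∉V head∈VP =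
      let f , f∈P , head-f = Reach⇒in-arc (reachable arbP _ head∈VP) (no-arc-into-root arbT e∈T)
      in e∉P (subst (_∈ P) (head-injective arbT (P⊆T f∈P) e∈T head-f) f∈P)

    leave : ∀ {x} → Reach T x → ¬ V P x → ∃ λ a → a ∈ T × V P (tail a) × ¬ V P (head a)
    leave root x∉V = ⊥-elim (x∉V r∈V)
    leave (step c c∈T refl R) x∉V with V? P (tail c)
    ... | yes tail∈VP = c , c∈T , tail∈VP , x∉V
    ... | no tail∉VP  = leave R tail∉VP

  TreeSequence : Subset m → Subset m → ℕ → Set
  TreeSequence X Y j = ∃ λ ℓ → Σ (Fin (suc ℓ) → Subset m) λ Ts →
    Ts zero ≡ X × Ts (fromℕ ℓ) ≡ Y ×
    (∀ i → IsRDirectedTree G r (Ts i)) ×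
    (∀ (i : Fin ℓ) → Exchange (Ts (inject₁ i)) (Ts (suc i))) ×
    ℓ ≤ j

  TreeSequence-refl : ∀ {X} → IsRDirectedTree G r X → TreeSequence X X 0
  TreeSequence-refl X-tree = 0 , (λ _ → _) , refl , refl , (λ _ → X-tree) , (λ ()) , z≤n

  TreeSequence-suc : ∀ {X Y j} → TreeSequence X Y j → TreeSequence X Y (suc j)
  TreeSequence-suc (ℓ , Ts , first , last , trees , steps , ℓ≤j) =
    ℓ , Ts , first , last , trees , steps , m≤n⇒m≤1+n ℓ≤j

  TreeSequence-∷ : ∀ {X X′ Y j} → IsRDirectedTree G r X → Exchange X X′ →
                   TreeSequence X′ Y j → TreeSequence X Y (suc j)
  TreeSequence-∷ {X} X-tree X→X′ (ℓ , Ts , refl , last , trees , steps , ℓ≤j) =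
    suc ℓ , Ts′ , refl , last , trees′ , steps′ , s≤s ℓ≤j
    where
    Ts′ : Fin (suc (suc ℓ)) → Subset m
    Ts′ zero    = X
    Ts′ (suc i) = Ts i
    trees′ : ∀ i → IsRDirectedTree G r (Ts′ i)
    trees′ zero    = X-tree
    trees′ (suc i) = trees i
    steps′ : ∀ (i : Fin (suc ℓ)) → Exchange (Ts′ (inject₁ i)) (Ts′ (suc i))
    steps′ zero    = X→X′
    steps′ (suc i) = steps i

  next-round : ∀ {X P T} → Arborescence X → Arborescence P → Arborescence T →
    P ⊆ X → P ⊆ T → ∣ P ∣ < ∣ T ∣ → ∣ X ∣ ≡ ∣ T ∣ →
    ∃ λ Q → Arborescence Q × Q ⊆ T × ∣ Q ∣ ≡ suc ∣ P ∣ × (Q ⊆ X ⊎ ExchangeStep Q X)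
  next-round {X} {P} {T} arbX arbP arbT P⊆X P⊆T ∣P∣<∣T∣ ∣X∣≡∣T∣
    with exit-arc arbP arbT P⊆T ∣P∣<∣T∣
  ... | a′ , a′∈T , tail∈VP , head∉VP =
    Q , arbQ , insert-⊆ P⊆T a′∈T , ∣Q∣≡1+∣P∣ ,
    advance arbX arbQ (∈-insert-self P a′) Q⊆X+a′ (V-mono P⊆X tail∈VP)
      (≤-trans (≤-reflexive ∣Q∣≡1+∣P∣) (subst (suc ∣ P ∣ ≤_) (sym ∣X∣≡∣T∣) ∣P∣<∣T∣))
    where
    Q = P [ a′ ]≔ inside
    arbQ = grow arbP tail∈VP head∉VP
    Q⊆X+a′ : Q ⊆ X [ a′ ]≔ inside
    Q⊆X+a′ = insert-⊆ (λ e∈P → ⊆-insert X a′ (P⊆X e∈P)) (∈-insert-self X a′)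
    ∣Q∣≡1+∣P∣ : ∣ Q ∣ ≡ suc ∣ P ∣
    ∣Q∣≡1+∣P∣ = ∣insert∣ P a′ (λ a′∈P → head∉VP (head∈V a′∈P))

  exchange-sequence : ∀ j {X P T} → Arborescence X → Arborescence P → Arborescence T →
    P ⊆ X → P ⊆ T → ∣ P ∣ + j ≡ ∣ T ∣ → ∣ X ∣ ≡ ∣ T ∣ → TreeSequence X T j
  exchange-sequence zero {X} {P} {T} arbX _ _ P⊆X P⊆T ∣P∣+0≡∣T∣ ∣X∣≡∣T∣ =
    subst (λ Y → TreeSequence X Y 0) (trans (sym P≡X) P≡T)
      (TreeSequence-refl (Arborescence⇒IsRDirectedTree arbX))
    where
    ∣P∣≡∣T∣ = trans (sym (+-identityʳ _)) ∣P∣+0≡∣T∣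
    P≡T = ⊆∧∣q∣≤∣p∣⇒≡ P⊆T (≤-reflexive (sym ∣P∣≡∣T∣))
    P≡X = ⊆∧∣q∣≤∣p∣⇒≡ P⊆X (≤-reflexive (trans ∣X∣≡∣T∣ (sym ∣P∣≡∣T∣)))
  exchange-sequence (suc j) {X} {P} arbX arbP arbT P⊆X P⊆T ∣P∣+1+j≡∣T∣ ∣X∣≡∣T∣
    with next-round arbX arbP arbT P⊆X P⊆T (subst (∣ P ∣ <_) ∣P∣+1+j≡∣T∣ (m<m+n ∣ P ∣ (s≤s z≤n))) ∣X∣≡∣T∣
  ... | Q , arbQ , Q⊆T , ∣Q∣≡1+∣P∣ , inj₁ Q⊆X =
    TreeSequence-suc
      (exchange-sequence j arbX arbQ arbT Q⊆X Q⊆T (shift-suc ∣Q∣≡1+∣P∣ ∣P∣+1+j≡∣T∣) ∣X∣≡∣T∣)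
  ... | Q , arbQ , Q⊆T , ∣Q∣≡1+∣P∣ , inj₂ (X′ , arbX′ , Q⊆X′ , X→X′ , ∣X′∣≡∣X∣) =
    TreeSequence-∷ (Arborescence⇒IsRDirectedTree arbX) X→X′
      (exchange-sequence j arbX′ arbQ arbT Q⊆X′ Q⊆T (shift-suc ∣Q∣≡1+∣P∣ ∣P∣+1+j≡∣T∣)
        (trans ∣X′∣≡∣X∣ ∣X∣≡∣T∣))

  ∅-arborescence : Arborescence ⊥
  ∅-arborescence = arborescence (λ h → ⊥-elim (∉⊥ h)) (λ h → ⊥-elim (∉⊥ h)) λ where
    x (inj₁ refl)          → root
    x (inj₂ (_ , h , _))   → ⊥-elim (∉⊥ h)


theorem5 : (G : Digraph) (r : Fin (Digraph.n G)) (T T′ : Subset (Digraph.m G)) (k : ℕ) →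
    IsRDirectedTree G r T → IsRDirectedTree G r T′ → ∣ T ∣ ≡ k → ∣ T′ ∣ ≡ k →
    ∃ λ ℓ → Σ (Fin (suc ℓ) → Subset (Digraph.m G)) λ Ts →
      Ts zero ≡ T × Ts (fromℕ ℓ) ≡ T′ ×
      (∀ i → IsRDirectedTree G r (Ts i)) ×
      (∀ (i : Fin ℓ) → ∣ Ts (inject₁ i) ─ Ts (suc i) ∣ ≡ 1 × ∣ Ts (suc i) ─ Ts (inject₁ i) ∣ ≡ 1) ×
      ℓ ≤ k
theorem5 G r T T′ k T-tree T′-tree ∣T∣≡k ∣T′∣≡k =
  exchange-sequence k (IsRDirectedTree⇒Arborescence T-tree) ∅-arborescence
    (IsRDirectedTree⇒Arborescence T′-tree) (⊆-min T) (⊆-min T′)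
    (trans (cong (_+ k) (∣⊥∣≡0 (Digraph.m G))) (sym ∣T′∣≡k)) (trans ∣T∣≡k (sym ∣T′∣≡k))
  where
  open Arborescences G r
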